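{- Let $U = u_1\cdots u_n$ be a finite word and $\lambda \in \Lambda(U)$. Then for every letter $a \ne u_{n-\lambda+1}$, the word $u_{n-\lambda+2}^{n}\,a$ is not a factor of $U$.
   Context: For $i\le j$, $u_i^j = u_i\cdots u_j$, and $u_i^{i-1}$ is the empty word. $\Lambda(U) = \{1 \le k < n : u_i = u_{i+k} \text{ for all } 1\le i\le n-k\}$. -}

module Defs where

open import Data.Nat using (ℕ; zero; suc; _+_; _≤_; _<_)
open import Data.List using (List; []; _∷_; _++_; length)
open import Data.Maybe using (Maybe; nothing; just)
open import Data.Product using (_×_; ∃-syntax)
open import Relation.Binary.PropositionalEquality using (_≡_)

-- 0-based safe lookup: (U at i) = just u_{i+1} when i < |U|, nothing otherwise.
_at_ : {A : Set} → List A → ℕ → Maybe A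
[]       at _       = nothing
(x ∷ xs) at zero    = just x
(x ∷ xs) at (suc i) = xs at i

-- k ∈ Λ(U): 1 ≤ k < n and u_i = u_{i+k} for all 1 ≤ i ≤ n - k
-- (stated with 0-based indices i, i + k < n).
InΛ : {A : Set} → List A → ℕ → Set
InΛ U k = (1 ≤ k) × (k < length U) ×
          (∀ i → i + k < length U → U at i ≡ U at (i + k))

Factor : {A : Set} → List A → List A → Set
Factor W U = ∃[ X ] ∃[ Y ] (U ≡ X ++ W ++ Y)

module Submission where

-- Let U have period L = k + 1 (the elements of Λ(U) are the periods
-- of U shorter than |U|), let m = |U| - L and W = u_{m+2} ⋯ u_n, so the
-- suffix of U of length L is u_{m+1} W.  In an L-periodic word, sliding a
-- window of length L one position to the right moves its first letter to
-- its end: consecutive windows are rotations of each other, hence all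
-- windows of length L are permutations of one another.  If W a occurred in
-- U at position p, the window at p would be W a and the window at m would
-- be u_{m+1} W; these are permutations of each other, and cancelling W
-- forces a = u_{m+1}, which is exactly what the hypothesis excludes.

open import Defs
open import Data.Nat using (ℕ; zero; suc; _+_; _∸_; _≤_; _<_; s≤s; z≤n)
open import Data.Nat.Properties
  using (+-comm; +-identityʳ; suc-injective; m≤m+n; m<m+n; <⇒≤; ≤-reflexive;
         +-monoʳ-≤; m∸n+n≡m; m+n∸m≡n)
open import Data.List using (List; []; _∷_; _++_; _∷ʳ_; length; take; drop; [_])
open import Data.List.Properties using (length-++; length-drop; drop-drop; take-all; ∷-injectiveˡ)
open import Data.List.Relation.Binary.Permutation.Propositional using (_↭_; ↭-refl; ↭-sym; ↭-trans)
open import Data.List.Relation.Binary.Permutation.Propositional.Properties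
  using (drop-mid; ↭-singleton-inv; ∷↭∷ʳ)
open import Data.Maybe using (just)
open import Data.Product using (∃-syntax; _×_; _,_; proj₁; proj₂)
open import Relation.Binary.PropositionalEquality
  using (_≡_; refl; sym; trans; cong; subst; subst₂; module ≡-Reasoning)
open import Relation.Nullary using (¬_)

module _ {A : Set} where

  at-drop : ∀ k (xs : List A) j → drop k xs at j ≡ xs at (k + j)
  at-drop zero    xs       j = refl
  at-drop (suc k) []       j = refl
  at-drop (suc k) (x ∷ xs) j = at-drop k xs j

  drop-at : ∀ k (xs : List A) → k < length xs →
            ∃[ x ] (xs at k ≡ just x × drop k xs ≡ x ∷ drop (suc k) xs)
  drop-at zero    (x ∷ xs) _          = x , refl , refl
  drop-at (suc k) (x ∷ xs) (s≤s k<n) = drop-at k xs k<n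

  take-suc : ∀ k (xs : List A) {y : A} → xs at k ≡ just y → take (suc k) xs ≡ take k xs ∷ʳ y
  take-suc zero    (x ∷ xs) refl = refl
  take-suc (suc k) (x ∷ xs) eq   = cong (x ∷_) (take-suc k xs eq)

  drop-++-length : ∀ (xs ys : List A) → drop (length xs) (xs ++ ys) ≡ ys
  drop-++-length []       ys = refl
  drop-++-length (x ∷ xs) ys = drop-++-length xs ys

  take-++-length : ∀ (xs ys : List A) → take (length xs) (xs ++ ys) ≡ xs
  take-++-length []       ys = refl
  take-++-length (x ∷ xs) ys = cong (x ∷_) (take-++-length xs ys)

  ↭-head-cancel : ∀ (zs : List A) {x y : A} → x ∷ zs ↭ y ∷ zs → x ≡ y
  ↭-head-cancel []       p = ∷-injectiveˡ (↭-singleton-inv p)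
  ↭-head-cancel (z ∷ zs) {x} {y} p = ↭-head-cancel zs (drop-mid {x = z} [ x ] [ y ] p)

  window : ℕ → List A → ℕ → List A
  window k xs i = take k (drop i xs)

  rotate-prefix : ∀ k (ys : List A) → ys at k ≡ ys at 0 → take k (drop 1 ys) ↭ take k ys
  rotate-prefix zero    ys       _  = ↭-refl
  rotate-prefix (suc k) []       _  = ↭-refl
  rotate-prefix (suc k) (y ∷ zs) eq =
    subst (_↭ y ∷ take k zs) (sym (take-suc k zs eq)) (↭-sym (∷↭∷ʳ y (take k zs)))

  slide-window : ∀ k (xs : List A) i → xs at (i + k) ≡ xs at i →
                 window k xs (suc i) ↭ window k xs i
  slide-window k xs i eq = subst (λ ys → take k ys ↭ window k xs i) drop-one
    (rotate-prefix k (drop i xs) shifted)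
    where
    open ≡-Reasoning
    drop-one : drop 1 (drop i xs) ≡ drop (suc i) xs
    drop-one = trans (drop-drop i 1 xs) (cong (λ j → drop j xs) (+-comm i 1))
    shifted : drop i xs at k ≡ drop i xs at 0
    shifted = begin
      drop i xs at k  ≡⟨ at-drop i xs k ⟩
      xs at (i + k)   ≡⟨ eq ⟩
      xs at i         ≡⟨ cong (xs at_) (sym (+-identityʳ i)) ⟩
      xs at (i + 0)   ≡⟨ sym (at-drop i xs 0) ⟩
      drop i xs at 0  ∎

  periodic-windows : ∀ k (xs : List A) →
                     (∀ i → i + k < length xs → xs at i ≡ xs at (i + k)) →
                     ∀ i → i + k ≤ length xs → window k xs i ↭ window k xs 0
  periodic-windows k xs periodic zero    _       = ↭-refl
  periodic-windows k xs periodic (suc i) i+k<n =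
    ↭-trans (slide-window k xs i (sym (periodic i i+k<n)))
            (periodic-windows k xs periodic i (<⇒≤ i+k<n))

  factor-window : ∀ L (X V Y U : List A) → length V ≡ L → U ≡ X ++ V ++ Y →
                  window L U (length X) ≡ V × length X + L ≤ length U
  factor-window _ X V Y _ refl refl =
    trans (cong (take (length V)) (drop-++-length X (V ++ Y))) (take-++-length V Y) ,
    subst (length X + length V ≤_) (sym (length-++ X))
      (+-monoʳ-≤ (length X) (subst (length V ≤_) (sym (length-++ V)) (m≤m+n _ _)))

  suffix-window : ∀ k m (xs : List A) → m + suc k ≡ length xs →
                  let W = drop (m + 1) xs in
                  ∃[ u ] (xs at m ≡ just u × window (suc k) xs m ≡ u ∷ W × length W ≡ k)
  suffix-window k m xs m+k+1≡n with drop-at m xs m<n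
    where
    m<n : m < length xs
    m<n = subst (m <_) m+k+1≡n (m<m+n m (s≤s z≤n))
  ... | u , xs[m]≡u , split = u , xs[m]≡u , suffix , length-W
    where
    open ≡-Reasoning
    split′ : drop m xs ≡ u ∷ drop (m + 1) xs
    split′ = trans split (cong (λ j → u ∷ drop j xs) (+-comm 1 m))
    length-suffix : length (drop m xs) ≡ suc k
    length-suffix = begin
      length (drop m xs)  ≡⟨ length-drop m xs ⟩
      length xs ∸ m       ≡⟨ cong (_∸ m) (sym m+k+1≡n) ⟩
      m + suc k ∸ m       ≡⟨ m+n∸m≡n m (suc k) ⟩
      suc k               ∎
    length-W : length (drop (m + 1) xs) ≡ k
    length-W = suc-injective (trans (cong length (sym split′)) length-suffix)
    suffix : window (suc k) xs m ≡ u ∷ drop (m + 1) xs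
    suffix = trans (cong (take (suc k)) split′)
                   (cong (u ∷_) (take-all k _ (≤-reflexive length-W)))

  conjugate-letter : ∀ (W : List A) {a u : A} → W ∷ʳ a ↭ u ∷ W → a ≡ u
  conjugate-letter W {a} p = ↭-head-cancel W (↭-trans (∷↭∷ʳ a W) p)

lemma5p3 : {A : Set} (U : List A) (λ′ : ℕ) → InΛ U λ′ →
    (a : A) → ¬ (U at (length U ∸ λ′) ≡ just a) →
    ¬ Factor (drop (length U ∸ λ′ + 1) U ++ [ a ]) U
lemma5p3 U (suc k) (_ , L<n , periodic) a U[m]≢a (X , Y , U≡XWaY)
  with suffix-window k (length U ∸ suc k) U (m∸n+n≡m (<⇒≤ L<n))
... | u , U[m]≡u , window-at-m , length-W =
  U[m]≢a (subst (λ v → U at m ≡ just v) (sym a≡u) U[m]≡u)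
  where
  m = length U ∸ suc k
  W = drop (m + 1) U
  length-Wa : length (W ∷ʳ a) ≡ suc k
  length-Wa = trans (length-++ W) (trans (+-comm (length W) 1) (cong suc length-W))
  window-at-p : window (suc k) U (length X) ≡ W ∷ʳ a
  window-at-p = proj₁ (factor-window (suc k) X (W ∷ʳ a) Y U length-Wa U≡XWaY)
  p-fits : length X + suc k ≤ length U
  p-fits = proj₂ (factor-window (suc k) X (W ∷ʳ a) Y U length-Wa U≡XWaY)
  windows-permute : window (suc k) U (length X) ↭ window (suc k) U m
  windows-permute = ↭-trans (periodic-windows (suc k) U periodic (length X) p-fits)
    (↭-sym (periodic-windows (suc k) U periodic m (≤-reflexive (m∸n+n≡m (<⇒≤ L<n)))))
  a≡u : a ≡ u
  a≡u = conjugate-letter W (subst₂ _↭_ window-at-p window-at-m windows-permute)
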